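{- Let $G$ be the caterpillar $C(l;m_1,m_2,\ldots,m_l)$ with $l\ge 2$, $m_1,m_l\ge 1$ and $m_2,\ldots,m_{l-1}\ge 0$. Then $\chi_p(G)=3$ if and only if $G$ belongs to (i.e. is isomorphic to a member of) $\mathcal{G}_1\cup\mathcal{G}_2\cup\cdots\cup\mathcal{G}_7$, where (all unspecified $m_i$ being arbitrary, subject to $m_1,m_l\ge 1$): $\mathcal{G}_1$: caterpillars $C(4k;m_1,\ldots,m_{4k})$, $k\ge 1$, with $m_i=0$ for every odd $i$ with $3\le i\le 4k-1$; $\mathcal{G}_2$: caterpillars $C(4k+1;m_1,\ldots,m_{4k+1})$, $k\ge 1$, with $m_1=1$ and $m_i=0$ for every odd $i$ with $3\le i\le 4k-1$; $\mathcal{G}_3$: caterpillars $C(4k+1;m_1,\ldots,m_{4k+1})$, $k\ge 1$, with $m_i=0$ for every even $i$ with $2\le i\le 4k$; $\mathcal{G}_4$: caterpillars $C(4k+2;m_1,\ldots,m_{4k+2})$, $k\ge 0$, with $m_i=0$ for every odd $i$ with $3\le i\le 4k+1$; $\mathcal{G}_5$: caterpillars $C(4k+3;m_1,\ldots,m_{4k+3})$, $k\ge 1$, with $m_i=0$ for every odd $i$ with $3\le i\le 4k+1$; $\mathcal{G}_6$: caterpillars $C(3;m_1,m_2,1)$; $\mathcal{G}_7$: caterpillars $C(4k+3;m_1,\ldots,m_{4k+3})$, $k\ge 0$, with $m_i=0$ for every even $i$ with $2\le i\le 4k+2$.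
   Context: A packing $k$-coloring of a graph $H$ is a map $c:V(H)\to\{1,\ldots,k\}$ such that any two distinct vertices $u,v$ with $c(u)=c(v)=i$ satisfy $d_H(u,v)\ge i+1$. The packing chromatic number $\chi_p(H)$ is the least such $k$. A caterpillar $C(l;m_1,\ldots,m_l)$ is the tree consisting of a path $v_1v_2\cdots v_l$ (the backbone) together with, for each $i\in\{1,\ldots,l\}$, exactly $m_i$ leaves (degree-one vertices) attached to $v_i$; removing all pendant edges leaves the backbone path. Caterpillars are regarded as graphs, so membership in a family is up to graph isomorphism (in particular, $C(l;m_1,\ldots,m_l)\cong C(l;m_l,\ldots,m_1)$). -}

module Defs where

open import Data.Nat using (ℕ; zero; suc; _+_; _*_; _∸_; _≤_; _<_)
open import Data.Fin using (Fin; toℕ)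
open import Data.Product using (Σ; ∃; _×_; _,_)
open import Data.Sum using (_⊎_)
open import Relation.Binary.PropositionalEquality using (_≡_; _≢_)
open import Relation.Nullary using (¬_)
open import Function.Bundles using (_↔_; Inverse; _⇔_)

record Graph : Set₁ where
  field
    V   : Set
    Adj : V → V → Set
open Graph public

data Walk (G : Graph) : V G → V G → ℕ → Set where
  here : ∀ {u} → Walk G u u zero
  step : ∀ {u w v n} → Adj G u w → Walk G w v n → Walk G u v (suc n)

-- d_G(u,v) ≥ k : there is no u–v walk of length < k
-- (this includes d = ∞ for disconnected graphs).
DistGe : (G : Graph) → V G → V G → ℕ → Set
DistGe G u v k = ∀ n → n < k → ¬ Walk G u v n

-- Packing colourings.  Colour  c : V → Fin k  represents the colour
-- toℕ c + 1 ∈ {1,…,k}; two distinct vertices with the same colour i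
-- must be at distance ≥ i + 1 = toℕ c + 2.

IsPackingColoring : (G : Graph) (k : ℕ) → (V G → Fin k) → Set
IsPackingColoring G k c =
  ∀ u v → u ≢ v → c u ≡ c v → DistGe G u v (suc (suc (toℕ (c u))))

PackingColorable : Graph → ℕ → Set
PackingColorable G k = Σ (V G → Fin k) (IsPackingColoring G k)

PackingChromaticNumberIs : Graph → ℕ → Set
PackingChromaticNumberIs G k =
  PackingColorable G k × (∀ j → j < k → ¬ PackingColorable G j)

record Iso (G H : Graph) : Set where
  field
    bij     : V G ↔ V H
  open Inverse bij public using (to)
  field
    adj⇔    : ∀ u v → Adj G u v ⇔ Adj H (to u) (to v)

-- Caterpillars C(l; m_1,…,m_l).  Backbone vertex v_i (1-based index
-- i = toℕ i' + 1 for i' : Fin l); m_i leaves attached to v_i.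

data CatV (l : ℕ) (m : Fin l → ℕ) : Set where
  spine : Fin l → CatV l m
  leaf  : (i : Fin l) → Fin (m i) → CatV l m

data CatAdj (l : ℕ) (m : Fin l → ℕ) : CatV l m → CatV l m → Set where
  spine-next : ∀ i j → suc (toℕ i) ≡ toℕ j → CatAdj l m (spine i) (spine j)
  spine-prev : ∀ i j → toℕ i ≡ suc (toℕ j) → CatAdj l m (spine i) (spine j)
  spine-leaf : ∀ i a → CatAdj l m (spine i) (leaf i a)
  leaf-spine : ∀ i a → CatAdj l m (leaf i a) (spine i)

Caterpillar : (l : ℕ) → (Fin l → ℕ) → Graph
Caterpillar l m = record { V = CatV l m ; Adj = CatAdj l m }

-- Conditions on the leaf sequence, in 1-based indexing:
-- the value m_p for p = toℕ i + 1.

Odd : ℕ → Set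
Odd p = Σ ℕ λ j → p ≡ suc (j + j)

Even : ℕ → Set
Even p = Σ ℕ λ j → p ≡ j + j

EndsPos : (l : ℕ) → (Fin l → ℕ) → Set
EndsPos l m = ∀ i → (toℕ i ≡ 0 ⊎ suc (toℕ i) ≡ l) → 1 ≤ m i

ZeroOn : (l : ℕ) → (Fin l → ℕ) → (ℕ → Set) → ℕ → ℕ → Set
ZeroOn l m P a b = ∀ i → P (suc (toℕ i)) → a ≤ suc (toℕ i) → suc (toℕ i) ≤ b → m i ≡ 0

ValAt : (l : ℕ) → (Fin l → ℕ) → ℕ → ℕ → Set
ValAt l m p v = ∀ i → suc (toℕ i) ≡ p → m i ≡ v

𝒢₁ 𝒢₂ 𝒢₃ 𝒢₄ 𝒢₅ 𝒢₆ 𝒢₇ : (l : ℕ) → (Fin l → ℕ) → Set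
𝒢₁ l m = EndsPos l m × Σ ℕ λ k → 1 ≤ k × l ≡ 4 * k × ZeroOn l m Odd 3 (4 * k ∸ 1)
𝒢₂ l m = EndsPos l m × Σ ℕ λ k → 1 ≤ k × l ≡ 4 * k + 1 × ValAt l m 1 1 × ZeroOn l m Odd 3 (4 * k ∸ 1)
𝒢₃ l m = EndsPos l m × Σ ℕ λ k → 1 ≤ k × l ≡ 4 * k + 1 × ZeroOn l m Even 2 (4 * k)
𝒢₄ l m = EndsPos l m × Σ ℕ λ k → l ≡ 4 * k + 2 × ZeroOn l m Odd 3 (4 * k + 1)
𝒢₅ l m = EndsPos l m × Σ ℕ λ k → 1 ≤ k × l ≡ 4 * k + 3 × ZeroOn l m Odd 3 (4 * k + 1)
𝒢₆ l m = EndsPos l m × l ≡ 3 × ValAt l m 3 1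
𝒢₇ l m = EndsPos l m × Σ ℕ λ k → l ≡ 4 * k + 3 × ZeroOn l m Even 2 (4 * k + 2)

InFamilies : (l : ℕ) → (Fin l → ℕ) → Set
InFamilies l m = 𝒢₁ l m ⊎ 𝒢₂ l m ⊎ 𝒢₃ l m ⊎ 𝒢₄ l m ⊎ 𝒢₅ l m ⊎ 𝒢₆ l m ⊎ 𝒢₇ l m

BelongsToFamilies : Graph → Set
BelongsToFamilies G =
  Σ ℕ λ l → Σ (Fin l → ℕ) λ m → InFamilies l m × Iso G (Caterpillar l m)

{-# OPTIONS --safe #-}
module Submission where

-- A packing 3-colouring restricts to a packing colouring of the path P formed by the backbone
-- and one leaf at each end; as P has at least four vertices, colour 3 is needed. In a packed
-- path every window of six vertices has colour 1 on one of its two middle vertices, so on the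
-- interior of P colour 1 occupies exactly the positions of one parity. A backbone vertex of
-- colour 1 with a leaf is the centre of a claw whose other three vertices use only colours 2
-- and 3, so two of them clash at distance 2: the interior backbone vertices of that parity carry
-- no leaves, and an end of colour 1 carries a single leaf. If colour 1 is on the odd positions
-- and l = 3 or l ≡ 1 (mod 4), colours 2 and 3 would alternate with period 4 on the even
-- positions and clash near the far end, so one end has colour 1. Read according to l mod 4, and
-- up to reversing the backbone, these conditions are exactly the families 𝒢₁, …, 𝒢₇.
-- Conversely, each family is coloured by extending a colouring of P built from the periodic
-- pattern 3 1 2 1, giving every other leaf colour 1.

open import Defs
open import Axiom.UniquenessOfIdentityProofs using (module Decidable⇒UIP)
open import Data.Bool using (Bool; true; _∧_; T)
open import Data.Bool.Properties using (T-∧)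
open import Data.Empty using (⊥; ⊥-elim)
open import Data.Fin using (Fin; zero; suc; toℕ; _≟_; inject≤; fromℕ; fromℕ<; opposite)
open import Data.Fin.Properties
  using (all?; toℕ-inject≤; inject≤-injective; toℕ<n; toℕ-injective; toℕ-fromℕ; toℕ-fromℕ<;
         fromℕ<-toℕ; opposite-prop; opposite-involutive)
open import Data.List using (List; []; _∷_; _++_; length; applyUpTo)
open import Data.List.Properties using (++-assoc; length-++)
open import Data.Nat using (ℕ; zero; suc; _+_; _*_; _∸_; _≤_; _<_; z≤n; s≤s; ∣_-_∣; parity)
open import Data.Nat.Properties
  using (≤-refl; ≤-reflexive; ≤-trans; ≤-antisym; ≤-pred; <-irrefl; <-trans; <-≤-trans; ≤-<-trans;
         <⇒≤; <⇒≱; ≮⇒≥; ≤∧≢⇒<; <-cmp; _<?_; n≤1+n; n<1+n; m≤m+n; m≤n+m; m<m+n; 1+n≢n;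
         suc-injective; +-comm; +-assoc; +-suc; *-comm; *-suc; +-cancelʳ-≡;
         +-mono-≤; +-monoˡ-≤; +-monoʳ-≤; +-monoˡ-<; +-monoʳ-<; *-monoˡ-≤;
         m∸n+n≡m; m+n∸n≡m; [m+n]∸[m+o]≡n∸o;
         ∣n-n∣≡0; ∣-∣-comm; ∣-∣-triangle; m≤n⇒∣n-m∣≡n∸m; m≤n⇒∣m-n∣≡n∸m; module ≤-Reasoning)
  renaming (_≟_ to _≟ℕ_)
open import Data.Parity.Base as ℙ using (Parity; 0ℙ; 1ℙ; _⁻¹)
open import Data.Parity.Properties
  using (⁻¹-involutive; suc-homo-⁻¹; +-homo-+; *-homo-*; p+p≡0ℙ)
  renaming (+-assoc to ℙ-+-assoc; +-identityʳ to ℙ-+-identityʳ)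
open import Data.Product using (_×_; _,_; proj₁; proj₂)
open import Data.Sum as Sum using (_⊎_; inj₁; inj₂; [_,_]′)
open import Function using (_∘_; id)
open import Function.Bundles using (_⇔_; mk⇔; Equivalence; Injection; mk↔ₛ′)
open import Function.Construct.Identity using (↔-id; ⇔-id)
open import Function.Properties.Inverse using (↔⇒↣)
open import Relation.Binary using (tri<; tri≈; tri>)
open import Relation.Binary.PropositionalEquality
  using (_≡_; _≢_; refl; sym; trans; cong; cong₂; subst; subst₂; module ≡-Reasoning)
open import Relation.Binary.PropositionalEquality.Properties using (subst-∘)
open import Relation.Nullary using (¬_; yes; no)
open import Relation.Nullary.Decidable
  using (isNo; from-yes; toWitnessFalse; fromWitnessFalse; _→-dec_; _⊎-dec_; ¬?; T?)

Colour : Set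
Colour = Fin 3

pattern c₁ = zero
pattern c₂ = suc zero
pattern c₃ = suc (suc zero)

≢c₁⇒2< : ∀ (a : Colour) → a ≢ c₁ → 2 < suc (suc (toℕ a))
≢c₁⇒2< c₁ a≢c₁ = ⊥-elim (a≢c₁ refl)
≢c₁⇒2< (suc _) _ = s≤s (s≤s (s≤s z≤n))

two-of-three-coincide : ∀ (a b c : Colour) → a ≢ c₁ → b ≢ c₁ → c ≢ c₁ → a ≡ b ⊎ b ≡ c ⊎ a ≡ c
two-of-three-coincide = from-yes (all? λ (a : Colour) → all? λ (b : Colour) → all? λ (c : Colour) →
  ¬? (a ≟ c₁) →-dec ¬? (b ≟ c₁) →-dec ¬? (c ≟ c₁) →-dec ((a ≟ b) ⊎-dec (b ≟ c) ⊎-dec (a ≟ c)))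

PathPacking : ∀ {k} → (ℕ → Fin k) → ℕ → Set
PathPacking t n = ∀ {p q} → p < q → q < n → t p ≡ t q → suc (suc (toℕ (t p))) ≤ q ∸ p

module _ {G : Graph} where

  walk-length-0 : ∀ {u v} → Walk G u v 0 → u ≡ v
  walk-length-0 here = refl

  walk-length-1 : ∀ {u v} → Walk G u v 1 → Adj G u v
  walk-length-1 (step a here) = a

  walk-displacement : (f : V G → ℕ) → (∀ {x y} → Adj G x y → ∣ f x - f y ∣ ≤ 1) →
                      ∀ {u v n} → Walk G u v n → ∣ f u - f v ∣ ≤ n
  walk-displacement f lip {u} here = subst (_≤ 0) (sym (∣n-n∣≡0 (f u))) z≤n
  walk-displacement f lip {u} {v} (step {w = w} a p) =
    ≤-trans (∣-∣-triangle (f u) (f w) (f v)) (+-mono-≤ (lip a) (walk-displacement f lip p))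

  packing-from-layout : ∀ {k} (c : V G → Fin (suc k)) (f : V G → ℕ) →
    (∀ {x y} → Adj G x y → ∣ f x - f y ∣ ≤ 1) →
    (∀ {x y} → Adj G x y → c x ≡ zero → c y ≢ zero) →
    (∀ x y → x ≢ y → c x ≡ c y → c x ≢ zero → suc (suc (toℕ (c x))) ≤ ∣ f x - f y ∣) →
    IsPackingColoring G (suc k) c
  packing-from-layout c f lip indep sep u v u≢v same n n<d w with c u ≟ zero
  ... | no cu≢0 = <⇒≱ n<d (≤-trans (sep u v u≢v same cu≢0) (walk-displacement f lip w))
  ... | yes cu with subst (λ x → n < suc (suc (toℕ x))) cu n<d
  ...   | s≤s z≤n = u≢v (walk-length-0 w)
  ...   | s≤s (s≤s z≤n) = indep (walk-length-1 w) cu (trans (sym same) cu)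

  packing-inject≤ : ∀ {j k c} → IsPackingColoring G j c → (j≤k : j ≤ k) →
                    IsPackingColoring G k (λ x → inject≤ (c x) j≤k)
  packing-inject≤ {c = c} pk j≤k u v u≢v same =
    subst (λ i → DistGe G u v (suc (suc i))) (sym (toℕ-inject≤ (c u) j≤k))
          (pk u v u≢v (inject≤-injective j≤k j≤k (c u) (c v) same))

  packing-restricts-to-path : ∀ {k c} → IsPackingColoring G k c → (e : ℕ → V G) (n : ℕ) →
    (∀ {p} → suc p < n → Adj G (e p) (e (suc p))) →
    (∀ {p q} → p < n → q < n → e p ≡ e q → p ≡ q) →
    PathPacking (c ∘ e) n
  packing-restricts-to-path {c = c} pk e n adj inj {p} {q} p<q q<n same =
    ≮⇒≥ λ short → pk (e p) (e q) ep≢eq same (q ∸ p) short path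
    where
    ep≢eq : e p ≢ e q
    ep≢eq ep≡eq = <-irrefl (inj (<-trans p<q q<n) q<n ep≡eq) p<q
    walk-along : ∀ d {r} → d + r < n → Walk G (e r) (e (d + r)) d
    walk-along zero h = here
    walk-along (suc d) {r} h =
      step (adj (≤-<-trans (s≤s (m≤n+m r d)) h))
           (subst (λ s → Walk G (e (suc r)) (e s) d) (+-suc d r)
                  (walk-along d (subst (_< n) (sym (+-suc d r)) h)))
    q∸p+p≡q : q ∸ p + p ≡ q
    q∸p+p≡q = m∸n+n≡m (<⇒≤ p<q)
    path : Walk G (e p) (e q) (q ∸ p)
    path = subst (λ s → Walk G (e p) (e s) (q ∸ p)) q∸p+p≡q
                 (walk-along (q ∸ p) (subst (_< n) (sym q∸p+p≡q) q<n))

  claw-centre-≢c₁ : (∀ {x y} → Adj G x y → Adj G y x) → (∀ {x} → ¬ Adj G x x) →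
    ∀ {c} → IsPackingColoring G 3 c → ∀ {w x y z} → Adj G w x → Adj G w y → Adj G w z →
    x ≢ y → y ≢ z → x ≢ z → c w ≢ c₁
  claw-centre-≢c₁ adj-sym irrefl {c} pk {w} {x} {y} {z} wx wy wz x≢y y≢z x≢z cw =
    [ apart wx wy x≢y , [ apart wy wz y≢z , apart wx wz x≢z ]′ ]′
      (two-of-three-coincide (c x) (c y) (c z) (neighbour-≢c₁ wx) (neighbour-≢c₁ wy) (neighbour-≢c₁ wz))
    where
    neighbour-≢c₁ : ∀ {u} → Adj G w u → c u ≢ c₁
    neighbour-≢c₁ {u} wu cu =
      pk u w (λ { refl → irrefl wu }) (trans cu (sym cw)) 1 (s≤s (s≤s z≤n)) (step (adj-sym wu) here)
    apart : ∀ {u u′} → Adj G w u → Adj G w u′ → u ≢ u′ → c u ≢ c u′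
    apart {u} wu wu′ u≢u′ same =
      pk _ _ u≢u′ same 2 (≢c₁⇒2< (c u) (neighbour-≢c₁ wu)) (step (adj-sym wu) (step wu′ here))

PackingColorable-pullback : ∀ {G H k} → Iso G H → PackingColorable H k → PackingColorable G k
PackingColorable-pullback {G} {H} iso (c , pk) =
  c ∘ to , λ u v u≢v same d d<k w →
    pk (to u) (to v) (u≢v ∘ Injection.injective (↔⇒↣ bij)) same d d<k (map-walk w)
  where
  open Iso iso
  map-walk : ∀ {u v d} → Walk G u v d → Walk H (to u) (to v) d
  map-walk here = here
  map-walk (step a w) = step (Equivalence.to (adj⇔ _ _) a) (map-walk w)

notInFirst : ∀ {k} → ℕ → Fin k → List (Fin k) → Bool
notInFirst zero x ys = true
notInFirst (suc r) x [] = true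
notInFirst (suc r) x (y ∷ ys) = isNo (x ≟ y) ∧ notInFirst r x ys

packingᵇ : ∀ {k} → List (Fin k) → Bool
packingᵇ [] = true
packingᵇ (x ∷ xs) = notInFirst (suc (toℕ x)) x xs ∧ packingᵇ xs

notInFirst-applyUpTo : ∀ {k} r (x : Fin k) f n →
  T (notInFirst r x (applyUpTo f n)) ⇔ (∀ d → d < r → d < n → x ≢ f d)
notInFirst-applyUpTo zero x f n = mk⇔ (λ _ _ ()) _
notInFirst-applyUpTo (suc r) x f zero = mk⇔ (λ _ _ _ ()) _
notInFirst-applyUpTo (suc r) x f (suc n) = mk⇔ to from
  where
  rest : T (notInFirst r x (applyUpTo (f ∘ suc) n)) ⇔ (∀ d → d < r → d < n → x ≢ f (suc d))
  rest = notInFirst-applyUpTo r x (f ∘ suc) n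
  to : T (isNo (x ≟ f 0) ∧ notInFirst r x (applyUpTo (f ∘ suc) n)) → ∀ d → d < suc r → d < suc n → x ≢ f d
  to h zero _ _ = toWitnessFalse (proj₁ (Equivalence.to (T-∧ {isNo (x ≟ f 0)}) h))
  to h (suc d) d<r d<n =
    Equivalence.to rest (proj₂ (Equivalence.to (T-∧ {isNo (x ≟ f 0)}) h)) d (≤-pred d<r) (≤-pred d<n)
  from : (∀ d → d < suc r → d < suc n → x ≢ f d) → T (isNo (x ≟ f 0) ∧ notInFirst r x (applyUpTo (f ∘ suc) n))
  from h = Equivalence.from (T-∧ {isNo (x ≟ f 0)})
    ( fromWitnessFalse (h 0 (s≤s z≤n) (s≤s z≤n))
    , Equivalence.from rest (λ d d<r d<n → h (suc d) (s≤s d<r) (s≤s d<n)) )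

PathPacking⇔packingᵇ : ∀ {k} (t : ℕ → Fin k) n → PathPacking t n ⇔ T (packingᵇ (applyUpTo t n))
PathPacking⇔packingᵇ t zero = mk⇔ _ (λ _ {_} {_} _ ())
PathPacking⇔packingᵇ t (suc n) = mk⇔ to from
  where
  rest : PathPacking (t ∘ suc) n ⇔ T (packingᵇ (applyUpTo (t ∘ suc) n))
  rest = PathPacking⇔packingᵇ (t ∘ suc) n
  first : T (notInFirst (suc (toℕ (t 0))) (t 0) (applyUpTo (t ∘ suc) n)) ⇔
          (∀ d → d < suc (toℕ (t 0)) → d < n → t 0 ≢ t (suc d))
  first = notInFirst-applyUpTo (suc (toℕ (t 0))) (t 0) (t ∘ suc) n
  to : PathPacking t (suc n) → T (packingᵇ (applyUpTo t (suc n)))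
  to pk = Equivalence.from T-∧
    ( Equivalence.from first (λ d d<r d<n eq → <⇒≱ d<r (≤-pred (pk (s≤s z≤n) (s≤s d<n) eq)))
    , Equivalence.to rest (λ p<q q<n eq → pk (s≤s p<q) (s≤s q<n) eq) )
  from : T (packingᵇ (applyUpTo t (suc n))) → PathPacking t (suc n)
  from h {zero} {suc d} _ q<n eq =
    ≮⇒≥ λ d<r → Equivalence.to first (proj₁ (Equivalence.to T-∧ h)) d (≤-pred d<r) (≤-pred q<n) eq
  from h {suc p} {suc q} p<q q<n eq =
    Equivalence.from rest (proj₂ (Equivalence.to T-∧ h)) (≤-pred p<q) (≤-pred q<n) eq

PathPacking-window : ∀ {k} {t : ℕ → Fin k} {n} → PathPacking t n → ∀ q {w} → w + q ≤ n →
                     PathPacking (λ i → t (i + q)) w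
PathPacking-window {t = t} pk q h {p} {p′} p<p′ p′<w eq =
  subst (suc (suc (toℕ (t (p + q)))) ≤_) (∸-cancelʳ p′ p)
        (pk (+-monoˡ-< q p<p′) (<-≤-trans (+-monoˡ-< q p′<w) h) eq)
  where
  ∸-cancelʳ : ∀ a b → (a + q) ∸ (b + q) ≡ a ∸ b
  ∸-cancelʳ a b = trans (cong₂ _∸_ (+-comm a q) (+-comm b q)) ([m+n]∸[m+o]≡n∸o q a b)

PathPacking-apart : ∀ {k} {t : ℕ → Fin k} {n} → PathPacking t n → ∀ {p q} → p < n → q < n → p ≢ q →
                    t p ≡ t q → suc (suc (toℕ (t p))) ≤ ∣ p - q ∣
PathPacking-apart {t = t} pk {p} {q} p<n q<n p≢q same with <-cmp p q
... | tri< p<q _ _ = subst (_ ≤_) (sym (m≤n⇒∣m-n∣≡n∸m (<⇒≤ p<q))) (pk p<q q<n same)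
... | tri≈ _ p≡q _ = ⊥-elim (p≢q p≡q)
... | tri> _ _ q<p = subst₂ _≤_ (cong (λ c → suc (suc (toℕ c))) (sym same))
                            (sym (m≤n⇒∣n-m∣≡n∸m (<⇒≤ q<p))) (pk q<p p<n (sym same))

module _ {t : ℕ → Colour} where

  private
    packed : ∀ {n} → PathPacking t n → T (packingᵇ (applyUpTo t n))
    packed {n} = Equivalence.to (PathPacking⇔packingᵇ t n)

  c₁-among-three : PathPacking t 3 → t 0 ≡ c₁ ⊎ t 1 ≡ c₁ ⊎ t 2 ≡ c₁
  c₁-among-three pk = decided (t 0) (t 1) (t 2) (packed pk)
    where
    decided : ∀ (x₀ x₁ x₂ : Colour) → T (packingᵇ (x₀ ∷ x₁ ∷ x₂ ∷ [])) → x₀ ≡ c₁ ⊎ x₁ ≡ c₁ ⊎ x₂ ≡ c₁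
    decided = from-yes (all? λ (x₀ : Colour) → all? λ (x₁ : Colour) → all? λ (x₂ : Colour) →
      T? (packingᵇ (x₀ ∷ x₁ ∷ x₂ ∷ [])) →-dec ((x₀ ≟ c₁) ⊎-dec (x₁ ≟ c₁) ⊎-dec (x₂ ≟ c₁)))

  c₃-among-four : PathPacking t 4 → t 0 ≡ c₃ ⊎ t 1 ≡ c₃ ⊎ t 2 ≡ c₃ ⊎ t 3 ≡ c₃
  c₃-among-four pk = decided (t 0) (t 1) (t 2) (t 3) (packed pk)
    where
    decided : ∀ (x₀ x₁ x₂ x₃ : Colour) → T (packingᵇ (x₀ ∷ x₁ ∷ x₂ ∷ x₃ ∷ [])) →
              x₀ ≡ c₃ ⊎ x₁ ≡ c₃ ⊎ x₂ ≡ c₃ ⊎ x₃ ≡ c₃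
    decided = from-yes (all? λ (x₀ : Colour) → all? λ (x₁ : Colour) →
      all? λ (x₂ : Colour) → all? λ (x₃ : Colour) →
      T? (packingᵇ (x₀ ∷ x₁ ∷ x₂ ∷ x₃ ∷ [])) →-dec
      ((x₀ ≟ c₃) ⊎-dec (x₁ ≟ c₃) ⊎-dec (x₂ ≟ c₃) ⊎-dec (x₃ ≟ c₃)))

  c₁-at-2-or-3-of-six : PathPacking t 6 → t 2 ≡ c₁ ⊎ t 3 ≡ c₁
  c₁-at-2-or-3-of-six pk = decided (t 0) (t 1) (t 2) (t 3) (t 4) (t 5) (packed pk)
    where
    decided : ∀ (x₀ x₁ x₂ x₃ x₄ x₅ : Colour) → T (packingᵇ (x₀ ∷ x₁ ∷ x₂ ∷ x₃ ∷ x₄ ∷ x₅ ∷ [])) →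
              x₂ ≡ c₁ ⊎ x₃ ≡ c₁
    decided = from-yes (all? λ (x₀ : Colour) → all? λ (x₁ : Colour) → all? λ (x₂ : Colour) →
      all? λ (x₃ : Colour) → all? λ (x₄ : Colour) → all? λ (x₅ : Colour) →
      T? (packingᵇ (x₀ ∷ x₁ ∷ x₂ ∷ x₃ ∷ x₄ ∷ x₅ ∷ [])) →-dec ((x₂ ≟ c₁) ⊎-dec (x₃ ≟ c₁)))

  c₃-forced : PathPacking t 4 → t 0 ≢ c₁ → t 1 ≢ c₁ → t 3 ≢ c₁ → t 1 ≡ c₃
  c₃-forced pk = decided (t 0) (t 1) (t 2) (t 3) (packed pk)
    where
    decided : ∀ (x₀ x₁ x₂ x₃ : Colour) → T (packingᵇ (x₀ ∷ x₁ ∷ x₂ ∷ x₃ ∷ [])) →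
              x₀ ≢ c₁ → x₁ ≢ c₁ → x₃ ≢ c₁ → x₁ ≡ c₃
    decided = from-yes (all? λ (x₀ : Colour) → all? λ (x₁ : Colour) →
      all? λ (x₂ : Colour) → all? λ (x₃ : Colour) →
      T? (packingᵇ (x₀ ∷ x₁ ∷ x₂ ∷ x₃ ∷ [])) →-dec
      ¬? (x₀ ≟ c₁) →-dec ¬? (x₁ ≟ c₁) →-dec ¬? (x₃ ≟ c₁) →-dec (x₁ ≟ c₃))

  non-c₁-period-4 : PathPacking t 5 → t 0 ≢ c₁ → t 2 ≢ c₁ → t 4 ≢ c₁ → t 0 ≡ t 4
  non-c₁-period-4 pk = decided (t 0) (t 1) (t 2) (t 3) (t 4) (packed pk)
    where
    decided : ∀ (x₀ x₁ x₂ x₃ x₄ : Colour) → T (packingᵇ (x₀ ∷ x₁ ∷ x₂ ∷ x₃ ∷ x₄ ∷ [])) →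
              x₀ ≢ c₁ → x₂ ≢ c₁ → x₄ ≢ c₁ → x₀ ≡ x₄
    decided = from-yes (all? λ (x₀ : Colour) → all? λ (x₁ : Colour) → all? λ (x₂ : Colour) →
      all? λ (x₃ : Colour) → all? λ (x₄ : Colour) →
      T? (packingᵇ (x₀ ∷ x₁ ∷ x₂ ∷ x₃ ∷ x₄ ∷ [])) →-dec
      ¬? (x₀ ≟ c₁) →-dec ¬? (x₂ ≟ c₁) →-dec ¬? (x₄ ≟ c₁) →-dec (x₀ ≟ x₄))

  c₁-soon-after-c₃ : PathPacking t 4 → t 0 ≡ c₃ → t 2 ≡ c₁ ⊎ t 3 ≡ c₁
  c₁-soon-after-c₃ pk = decided (t 0) (t 1) (t 2) (t 3) (packed pk)
    where
    decided : ∀ (x₀ x₁ x₂ x₃ : Colour) → T (packingᵇ (x₀ ∷ x₁ ∷ x₂ ∷ x₃ ∷ [])) →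
              x₀ ≡ c₃ → x₂ ≡ c₁ ⊎ x₃ ≡ c₁
    decided = from-yes (all? λ (x₀ : Colour) → all? λ (x₁ : Colour) →
      all? λ (x₂ : Colour) → all? λ (x₃ : Colour) →
      T? (packingᵇ (x₀ ∷ x₁ ∷ x₂ ∷ x₃ ∷ [])) →-dec (x₀ ≟ c₃) →-dec ((x₂ ≟ c₁) ⊎-dec (x₃ ≟ c₁)))

2≰1 : ¬ 2 ≤ 1
2≰1 (s≤s ())

c₁-indicator : Colour → Parity
c₁-indicator c₁ = 1ℙ
c₁-indicator (suc _) = 0ℙ

c₁-indicator-≢c₁ : ∀ {x} → x ≢ c₁ → c₁-indicator x ≡ 0ℙ
c₁-indicator-≢c₁ {c₁} x≢c₁ = ⊥-elim (x≢c₁ refl)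
c₁-indicator-≢c₁ {suc _} _ = refl

1ℙ≢0ℙ : 1ℙ ≢ 0ℙ
1ℙ≢0ℙ ()

parity-suc : ∀ n → parity (suc n) ≡ parity n ⁻¹
parity-suc n = trans (sym (⁻¹-involutive (parity (suc n)))) (cong _⁻¹ (suc-homo-⁻¹ n))

⁻¹-distribˡ-+ : ∀ a b → (a ℙ.+ b) ⁻¹ ≡ a ⁻¹ ℙ.+ b
⁻¹-distribˡ-+ 0ℙ b = refl
⁻¹-distribˡ-+ 1ℙ b = ⁻¹-involutive b

parity[i*4]≡0ℙ : ∀ i → parity (i * 4) ≡ 0ℙ
parity[i*4]≡0ℙ zero = refl
parity[i*4]≡0ℙ (suc i) = parity[i*4]≡0ℙ i

module _ {t : ℕ → Colour} {n : ℕ} (pk : PathPacking t n) where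

  c₁-not-adjacent : ∀ {p} → suc p < n → t p ≡ c₁ → t (suc p) ≢ c₁
  c₁-not-adjacent {p} h tp tp′ =
    2≰1 (subst₂ (λ c d → suc (suc (toℕ c)) ≤ d) tp (m+n∸n≡m 1 p) (pk (n<1+n p) h (trans tp (sym tp′))))

  c₁-indicator-alternates : ∀ q → 6 + q ≤ n → c₁-indicator (t (3 + q)) ≡ c₁-indicator (t (2 + q)) ⁻¹
  c₁-indicator-alternates q h = [ second-not , first-not ]′ (c₁-at-2-or-3-of-six (PathPacking-window pk q h))
    where
    adjacent : suc (2 + q) < n
    adjacent = ≤-trans (s≤s (s≤s (s≤s (s≤s (m≤n+m q 2))))) h
    second-not : t (2 + q) ≡ c₁ → c₁-indicator (t (3 + q)) ≡ c₁-indicator (t (2 + q)) ⁻¹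
    second-not e = trans (c₁-indicator-≢c₁ (c₁-not-adjacent adjacent e)) (cong (λ x → c₁-indicator x ⁻¹) (sym e))
    first-not : t (3 + q) ≡ c₁ → c₁-indicator (t (3 + q)) ≡ c₁-indicator (t (2 + q)) ⁻¹
    first-not e =
      trans (cong c₁-indicator e) (cong _⁻¹ (sym (c₁-indicator-≢c₁ λ e′ → c₁-not-adjacent adjacent e′ e)))

c₁-indicator-interior : ∀ {t L} → PathPacking t (2 + L) → ∀ j → 3 + j ≤ L →
                        c₁-indicator (t (2 + j)) ≡ parity j ℙ.+ c₁-indicator (t 2)
c₁-indicator-interior pk zero _ = refl
c₁-indicator-interior {t} pk (suc j) h = begin
  c₁-indicator (t (3 + j))              ≡⟨ c₁-indicator-alternates pk j (s≤s (s≤s h)) ⟩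
  c₁-indicator (t (2 + j)) ⁻¹           ≡⟨ cong _⁻¹ (c₁-indicator-interior pk j (≤-trans (n≤1+n _) h)) ⟩
  (parity j ℙ.+ c₁-indicator (t 2)) ⁻¹  ≡⟨ ⁻¹-distribˡ-+ (parity j) (c₁-indicator (t 2)) ⟩
  parity j ⁻¹ ℙ.+ c₁-indicator (t 2)    ≡⟨ cong (ℙ._+ c₁-indicator (t 2)) (sym (parity-suc j)) ⟩
  parity (suc j) ℙ.+ c₁-indicator (t 2) ∎
  where open ≡-Reasoning

+≡1ℙ⇔≡⁻¹ : ∀ a b → a ℙ.+ b ≡ 1ℙ ⇔ a ≡ b ⁻¹
+≡1ℙ⇔≡⁻¹ 0ℙ 0ℙ = mk⇔ (λ ()) (λ ())
+≡1ℙ⇔≡⁻¹ 0ℙ 1ℙ = mk⇔ (λ _ → refl) (λ _ → refl)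
+≡1ℙ⇔≡⁻¹ 1ℙ 0ℙ = mk⇔ (λ _ → refl) (λ _ → refl)
+≡1ℙ⇔≡⁻¹ 1ℙ 1ℙ = mk⇔ (λ ()) (λ ())

c₁-indicator≡1ℙ⇔c₁ : ∀ x → c₁-indicator x ≡ 1ℙ ⇔ x ≡ c₁
c₁-indicator≡1ℙ⇔c₁ c₁ = mk⇔ (λ _ → refl) (λ _ → refl)
c₁-indicator≡1ℙ⇔c₁ (suc _) = mk⇔ (λ ()) (λ ())

c₁-interior⇔parity : ∀ {t L} → PathPacking t (2 + L) → ∀ {p} → 2 ≤ p → p < L →
                     t p ≡ c₁ ⇔ parity p ≡ c₁-indicator (t 2) ⁻¹
c₁-interior⇔parity {t} pk {suc (suc j)} (s≤s (s≤s z≤n)) p<L = mk⇔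
  (λ tp≡c₁ → Equivalence.to (+≡1ℙ⇔≡⁻¹ _ _)
               (trans (sym indicator) (Equivalence.from (c₁-indicator≡1ℙ⇔c₁ _) tp≡c₁)))
  (λ parity≡ → Equivalence.to (c₁-indicator≡1ℙ⇔c₁ _)
                 (trans indicator (Equivalence.from (+≡1ℙ⇔≡⁻¹ _ _) parity≡)))
  where
  indicator : c₁-indicator (t (2 + j)) ≡ parity j ℙ.+ c₁-indicator (t 2)
  indicator = c₁-indicator-interior pk j p<L

-- If none of these is 1, colour 1 sits exactly on the odd interior positions, and colours 2 and 3
-- alternate with period 4 on the even ones, starting with 3 at position 2; the 3 at position
-- 2 + 4j then has no colour 1 at distance 2 or 3, which no packing allows.
c₁-near-ends : ∀ {t} j → PathPacking t (7 + j * 4) → t 1 ≡ c₁ ⊎ t 2 ≡ c₁ ⊎ t (5 + j * 4) ≡ c₁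
c₁-near-ends {t} j pk with t 1 ≟ c₁ | t 2 ≟ c₁ | t (5 + j * 4) ≟ c₁
... | yes t₁≡c₁ | _ | _ = inj₁ t₁≡c₁
... | no _ | yes t₂≡c₁ | _ = inj₂ (inj₁ t₂≡c₁)
... | no _ | no _ | yes tL≡c₁ = inj₂ (inj₂ tL≡c₁)
... | no t₁≢c₁ | no t₂≢c₁ | no tL≢c₁ =
  ⊥-elim ([ even-≢c₁ (2 + j * 4) ≤-refl (parity[i*4]≡0ℙ j) , tL≢c₁ ]′
            (c₁-soon-after-c₃ (PathPacking-window pk (2 + j * 4) (n≤1+n _)) (c₃-at j ≤-refl)))
  where
  even-≢c₁ : ∀ i → 3 + i ≤ 5 + j * 4 → parity i ≡ 0ℙ → t (2 + i) ≢ c₁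
  even-≢c₁ i h even c = 1ℙ≢0ℙ (begin
    1ℙ                    ≡⟨ cong _⁻¹ (sym (c₁-indicator-≢c₁ t₂≢c₁)) ⟩
    c₁-indicator (t 2) ⁻¹ ≡⟨ sym (Equivalence.to (c₁-interior⇔parity pk (s≤s (s≤s z≤n)) h) c) ⟩
    parity i              ≡⟨ even ⟩
    0ℙ                    ∎)
    where open ≡-Reasoning
  c₃-at : ∀ i → i ≤ j → t (2 + i * 4) ≡ c₃
  c₃-at zero _ =
    c₃-forced (PathPacking-window pk 1 (s≤s (s≤s (s≤s (s≤s (s≤s z≤n))))))
              t₁≢c₁ t₂≢c₁ (even-≢c₁ 2 (s≤s (s≤s (s≤s (s≤s (s≤s z≤n))))) refl)
  c₃-at (suc i) i<j =
    trans (sym (non-c₁-period-4 (PathPacking-window pk (2 + i * 4) (+-monoʳ-≤ 7 i*4≤j*4))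
                 (even-≢c₁ (i * 4) (below z≤n) (parity[i*4]≡0ℙ i))
                 (even-≢c₁ (2 + i * 4) (below (s≤s (s≤s z≤n))) (parity[i*4]≡0ℙ i))
                 (even-≢c₁ (4 + i * 4) (below ≤-refl) (parity[i*4]≡0ℙ i))))
          (c₃-at i (<⇒≤ i<j))
    where
    4+i*4≤j*4 : 4 + i * 4 ≤ j * 4
    4+i*4≤j*4 = *-monoˡ-≤ 4 i<j
    i*4≤j*4 : i * 4 ≤ j * 4
    i*4≤j*4 = ≤-trans (m≤n+m (i * 4) 4) 4+i*4≤j*4
    below : ∀ {r} → r ≤ 4 → 3 + (r + i * 4) ≤ 5 + j * 4
    below r≤4 = ≤-trans (+-monoʳ-≤ 3 (+-monoˡ-≤ (i * 4) r≤4))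
                        (≤-trans (+-monoʳ-≤ 3 4+i*4≤j*4) (≤-trans (n≤1+n _) (n≤1+n _)))

CatAdj-sym : ∀ {l m x y} → CatAdj l m x y → CatAdj l m y x
CatAdj-sym (spine-next i j e) = spine-prev j i (sym e)
CatAdj-sym (spine-prev i j e) = spine-next j i (sym e)
CatAdj-sym (spine-leaf i a) = leaf-spine i a
CatAdj-sym (leaf-spine i a) = spine-leaf i a

CatAdj-irrefl : ∀ {l m x} → ¬ CatAdj l m x x
CatAdj-irrefl (spine-next i .i e) = 1+n≢n e
CatAdj-irrefl (spine-prev i .i e) = 1+n≢n (sym e)

∣n-1+n∣≤1 : ∀ a → ∣ a - suc a ∣ ≤ 1
∣n-1+n∣≤1 zero = ≤-refl
∣n-1+n∣≤1 (suc a) = ∣n-1+n∣≤1 a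

∣1+n-n∣≤1 : ∀ a → ∣ suc a - a ∣ ≤ 1
∣1+n-n∣≤1 a = subst (_≤ 1) (∣-∣-comm a (suc a)) (∣n-1+n∣≤1 a)

LeaflessInterior : (l : ℕ) → (Fin l → ℕ) → Parity → Set
LeaflessInterior l m π =
  ∀ i → 2 ≤ suc (toℕ i) → suc (toℕ i) < l → parity (suc (toℕ i)) ≡ π → m i ≡ 0

Fin-subsingleton⇒≤1 : ∀ {k} → (∀ (a b : Fin k) → a ≡ b) → k ≤ 1
Fin-subsingleton⇒≤1 {zero} _ = z≤n
Fin-subsingleton⇒≤1 {suc zero} _ = ≤-refl
Fin-subsingleton⇒≤1 {suc (suc k)} all-equal with all-equal zero (suc zero)
... | ()

¬Fin⇒≡0 : ∀ {k} → ¬ Fin k → k ≡ 0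
¬Fin⇒≡0 {zero} _ = refl
¬Fin⇒≡0 {suc k} no-element = ⊥-elim (no-element zero)

≡1⇒Fin-subsingleton : ∀ {k} → k ≡ 1 → ∀ (a b : Fin k) → a ≡ b
≡1⇒Fin-subsingleton refl zero zero = refl

module Backbone (n : ℕ) (m : Fin (2 + n) → ℕ) where

  L : ℕ
  L = 2 + n

  G : Graph
  G = Caterpillar L m

  -- Positions along P: the first leaves sit at 0 and the last ones at L + 1, while every other
  -- leaf shares the position of its backbone vertex, so neighbours are at most 1 apart.
  position : CatV L m → ℕ
  position (spine i) = suc (toℕ i)
  position (leaf zero _) = 0
  position (leaf (suc i) _) with toℕ i ≟ℕ n
  ... | yes _ = suc L
  ... | no _ = suc (suc (toℕ i))

  position-spine-leaf : ∀ i a → ∣ position (spine i) - position (leaf i a) ∣ ≤ 1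
  position-spine-leaf zero a = ≤-refl
  position-spine-leaf (suc i) a with toℕ i ≟ℕ n
  ... | yes i≡n =
    subst (λ q → ∣ suc (suc (toℕ i)) - suc (suc (suc q)) ∣ ≤ 1) i≡n (∣n-1+n∣≤1 (suc (suc (toℕ i))))
  ... | no _ = subst (_≤ 1) (sym (∣n-n∣≡0 (suc (suc (toℕ i))))) z≤n

  position-lipschitz : ∀ {x y} → CatAdj L m x y → ∣ position x - position y ∣ ≤ 1
  position-lipschitz (spine-next i j e) =
    subst (λ q → ∣ suc (toℕ i) - suc q ∣ ≤ 1) e (∣n-1+n∣≤1 (toℕ i))
  position-lipschitz (spine-prev i j e) =
    subst (λ q → ∣ suc q - suc (toℕ j) ∣ ≤ 1) (sym e) (∣1+n-n∣≤1 (toℕ j))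
  position-lipschitz (spine-leaf i a) = position-spine-leaf i a
  position-lipschitz (leaf-spine i a) =
    subst (_≤ 1) (∣-∣-comm (position (spine i)) (position (leaf i a))) (position-spine-leaf i a)

  position-last-leaf : ∀ i a → toℕ i ≡ n → position (leaf (suc i) a) ≡ suc L
  position-last-leaf i a i≡n with toℕ i ≟ℕ n
  ... | yes _ = refl
  ... | no i≢n = ⊥-elim (i≢n i≡n)

  position-middle-leaf : ∀ i a → 2 ≤ suc (toℕ i) → suc (toℕ i) < L → position (leaf i a) ≡ suc (toℕ i)
  position-middle-leaf zero a (s≤s ()) _
  position-middle-leaf (suc i) a _ (s≤s (s≤s i<n)) with toℕ i ≟ℕ n
  ... | yes i≡n = ⊥-elim (<-irrefl i≡n i<n)
  ... | no _ = refl

  module Extension (t : ℕ → Colour) (pk : PathPacking t (2 + L)) where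

    colour : CatV L m → Colour
    colour (spine i) = t (suc (toℕ i))
    colour (leaf zero _) = t 0
    colour (leaf (suc i) _) with toℕ i ≟ℕ n
    ... | yes _ = t (suc L)
    ... | no _ = c₁

    colour-off-c₁ : ∀ x → colour x ≢ c₁ → colour x ≡ t (position x)
    colour-off-c₁ (spine i) _ = refl
    colour-off-c₁ (leaf zero a) _ = refl
    colour-off-c₁ (leaf (suc i) a) x≢c₁ with toℕ i ≟ℕ n
    ... | yes _ = refl
    ... | no _ = ⊥-elim (x≢c₁ refl)

    position<2+L : ∀ x → position x < 2 + L
    position<2+L (spine i) = s≤s (≤-trans (toℕ<n i) (n≤1+n _))
    position<2+L (leaf zero a) = s≤s z≤n
    position<2+L (leaf (suc i) a) with toℕ i ≟ℕ n
    ... | yes _ = ≤-refl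
    ... | no _ = s≤s (s≤s (≤-trans (toℕ<n i) (n≤1+n _)))

    position-injective-off-c₁ : (t 0 ≢ c₁ → ValAt L m 1 1) → (t (suc L) ≢ c₁ → ValAt L m L 1) →
                                ∀ x y → colour x ≢ c₁ → colour y ≢ c₁ → position x ≡ position y → x ≡ y
    position-injective-off-c₁ first last = go
      where
      last-leaves-equal : ∀ {i j} → i ≡ j → toℕ j ≡ n → t (suc L) ≢ c₁ →
                          ∀ a b → leaf {L} {m} (suc i) a ≡ leaf (suc j) b
      last-leaves-equal {j = j} refl j≡n tL≢c₁ a b =
        cong (leaf (suc j)) (≡1⇒Fin-subsingleton (last tL≢c₁ (suc j) (cong (2 +_) j≡n)) a b)
      spine≢last : ∀ (i : Fin L) → suc (toℕ i) ≢ suc L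
      spine≢last i e = <-irrefl (suc-injective e) (toℕ<n i)
      go : ∀ x y → colour x ≢ c₁ → colour y ≢ c₁ → position x ≡ position y → x ≡ y
      go (spine i) (spine j) _ _ e = cong spine (toℕ-injective (suc-injective e))
      go (leaf zero a) (leaf zero b) x≢c₁ _ _ =
        cong (leaf zero) (≡1⇒Fin-subsingleton (first x≢c₁ zero refl) a b)
      go (spine i) (leaf (suc j) b) _ y≢c₁ e with toℕ j ≟ℕ n
      ... | yes _ = ⊥-elim (spine≢last i e)
      ... | no _ = ⊥-elim (y≢c₁ refl)
      go (leaf (suc i) a) (spine j) x≢c₁ _ e with toℕ i ≟ℕ n
      ... | yes _ = ⊥-elim (spine≢last j (sym e))
      ... | no _ = ⊥-elim (x≢c₁ refl)
      go (leaf zero a) (leaf (suc j) b) _ y≢c₁ e with toℕ j ≟ℕ n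
      ... | no _ = ⊥-elim (y≢c₁ refl)
      go (leaf (suc i) a) (leaf zero b) x≢c₁ _ e with toℕ i ≟ℕ n
      ... | no _ = ⊥-elim (x≢c₁ refl)
      go (leaf (suc i) a) (leaf (suc j) b) x≢c₁ y≢c₁ e with toℕ i ≟ℕ n | toℕ j ≟ℕ n
      ... | yes i≡n | yes j≡n = last-leaves-equal (toℕ-injective (trans i≡n (sym j≡n))) j≡n y≢c₁ a b
      ... | no _ | _ = ⊥-elim (x≢c₁ refl)
      ... | yes _ | no _ = ⊥-elim (y≢c₁ refl)

    c₁-independent : LeaflessInterior L m (c₁-indicator (t 2) ⁻¹) →
                     ∀ {x y} → CatAdj L m x y → colour x ≡ c₁ → colour y ≢ c₁
    c₁-independent leafless = independent
      where
      spines : ∀ {i j} → suc (toℕ i) ≡ toℕ j → colour (spine i) ≡ c₁ → colour (spine j) ≢ c₁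
      spines {i} {j} e ci cj =
        c₁-not-adjacent pk (s≤s (s≤s (subst (_≤ L) (sym e) (<⇒≤ (toℕ<n j))))) ci
                        (subst (λ q → t (suc q) ≡ c₁) (sym e) cj)
      spine-and-leaf : ∀ i a → colour (spine i) ≡ c₁ → colour (leaf i a) ≢ c₁
      spine-and-leaf zero a ci ca = c₁-not-adjacent pk (s≤s (s≤s z≤n)) ca ci
      spine-and-leaf (suc i) a ci ca with toℕ i ≟ℕ n
      ... | yes i≡n = c₁-not-adjacent pk ≤-refl (subst (λ q → t (2 + q) ≡ c₁) i≡n ci) ca
      ... | no i≢n =
        no-leaf (subst Fin (leafless (suc i) 2≤ interior (Equivalence.to (c₁-interior⇔parity pk 2≤ interior) ci)) a)
        where
        2≤ : 2 ≤ 2 + toℕ i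
        2≤ = s≤s (s≤s z≤n)
        interior : 2 + toℕ i < L
        interior = s≤s (s≤s (≤∧≢⇒< (≤-pred (toℕ<n i)) i≢n))
        no-leaf : Fin 0 → ⊥
        no-leaf ()
      independent : ∀ {x y} → CatAdj L m x y → colour x ≡ c₁ → colour y ≢ c₁
      independent (spine-next i j e) = spines e
      independent (spine-prev i j e) cx cy = spines (sym e) cy cx
      independent (spine-leaf i a) = spine-and-leaf i a
      independent (leaf-spine i a) cx cy = spine-and-leaf i a cy cx

    extension-packing : LeaflessInterior L m (c₁-indicator (t 2) ⁻¹) →
                        (t 0 ≢ c₁ → ValAt L m 1 1) → (t (suc L) ≢ c₁ → ValAt L m L 1) →
                        IsPackingColoring G 3 colour
    extension-packing leafless first last =
      packing-from-layout colour position position-lipschitz (c₁-independent leafless) separated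
      where
      separated : ∀ x y → x ≢ y → colour x ≡ colour y → colour x ≢ c₁ →
                  suc (suc (toℕ (colour x))) ≤ ∣ position x - position y ∣
      separated x y x≢y same x≢c₁ =
        subst (λ c → suc (suc (toℕ c)) ≤ ∣ position x - position y ∣) (sym (colour-off-c₁ x x≢c₁))
          (PathPacking-apart pk (position<2+L x) (position<2+L y)
             (λ e → x≢y (position-injective-off-c₁ first last x y x≢c₁ y≢c₁ e))
             (trans (sym (colour-off-c₁ x x≢c₁)) (trans same (colour-off-c₁ y y≢c₁))))
        where
        y≢c₁ : colour y ≢ c₁
        y≢c₁ c = x≢c₁ (trans same c)

  module BackbonePath (ends : EndsPos L m) where

    lastᴸ : Fin L
    lastᴸ = fromℕ (suc n)

    toℕ-lastᴸ : suc (toℕ lastᴸ) ≡ L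
    toℕ-lastᴸ = cong suc (toℕ-fromℕ (suc n))

    first-leaf : Fin (m zero)
    first-leaf = fromℕ< (ends zero (inj₁ refl))

    last-leaf : Fin (m lastᴸ)
    last-leaf = fromℕ< (ends lastᴸ (inj₂ toℕ-lastᴸ))

    backbone-path : ℕ → CatV L m
    backbone-path zero = leaf zero first-leaf
    backbone-path (suc p) with p <? L
    ... | yes p<L = spine (fromℕ< p<L)
    ... | no _ = leaf lastᴸ last-leaf

    backbone-path-spine : ∀ i → backbone-path (suc (toℕ i)) ≡ spine i
    backbone-path-spine i with toℕ i <? L
    ... | yes i<L = cong spine (fromℕ<-toℕ i i<L)
    ... | no i≮L = ⊥-elim (i≮L (toℕ<n i))

    position-backbone-path : ∀ {p} → p < 2 + L → position (backbone-path p) ≡ p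
    position-backbone-path {zero} _ = refl
    position-backbone-path {suc p} p<2+L with p <? L
    ... | yes p<L = cong suc (toℕ-fromℕ< p<L)
    ... | no p≮L = trans (position-last-leaf (fromℕ n) last-leaf (toℕ-fromℕ n))
                         (cong suc (≤-antisym (≮⇒≥ p≮L) (≤-pred (≤-pred p<2+L))))

    backbone-path-injective : ∀ {p q} → p < 2 + L → q < 2 + L → backbone-path p ≡ backbone-path q → p ≡ q
    backbone-path-injective p< q< e =
      trans (sym (position-backbone-path p<)) (trans (cong position e) (position-backbone-path q<))

    backbone-path-adjacent : ∀ {p} → suc p < 2 + L → CatAdj L m (backbone-path p) (backbone-path (suc p))
    backbone-path-adjacent {zero} _ with 0 <? L
    ... | yes _ = leaf-spine zero first-leaf
    ... | no 0≮L = ⊥-elim (0≮L (s≤s z≤n))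
    backbone-path-adjacent {suc p} (s≤s (s≤s p<L)) with p <? L | suc p <? L
    ... | no p≮L | _ = ⊥-elim (p≮L p<L)
    ... | yes p<L | yes 1+p<L = spine-next _ _ (trans (cong suc (toℕ-fromℕ< p<L)) (sym (toℕ-fromℕ< 1+p<L)))
    ... | yes p<L | no 1+p≮L = spine-to-last (toℕ-injective (trans (toℕ-fromℕ< p<L)
                                 (trans (≤-antisym (≤-pred p<L) (≤-pred (≮⇒≥ 1+p≮L))) (sym (toℕ-fromℕ (suc n))))))
      where
      spine-to-last : ∀ {i} → i ≡ lastᴸ → CatAdj L m (spine i) (leaf lastᴸ last-leaf)
      spine-to-last refl = spine-leaf lastᴸ last-leaf

    path-packing : ∀ {k c} → IsPackingColoring G k c → PathPacking (c ∘ backbone-path) (2 + L)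
    path-packing pk =
      packing-restricts-to-path pk backbone-path (2 + L) backbone-path-adjacent backbone-path-injective

    position-separates : ∀ {x y a b} → position x ≡ a → position y ≡ b → a < b → x ≢ y
    position-separates refl refl a<b x≡y = <-irrefl (cong position x≡y) a<b

    module Forced {c : CatV L m → Colour} (pk : IsPackingColoring G 3 c) where

      t : ℕ → Colour
      t = c ∘ backbone-path

      claw : ∀ {w x y z} → CatAdj L m w x → CatAdj L m w y → CatAdj L m w z →
             x ≢ y → y ≢ z → x ≢ z → c w ≢ c₁
      claw = claw-centre-≢c₁ CatAdj-sym CatAdj-irrefl pk

      no-leaf-at-interior-c₁ : ∀ i → 2 ≤ suc (toℕ i) → suc (toℕ i) < L → c (spine i) ≡ c₁ → ¬ Fin (m i)
      no-leaf-at-interior-c₁ i 2≤p p<L ci a =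
        claw (subst (λ w → CatAdj L m w (backbone-path (toℕ i))) (backbone-path-spine i)
                    (CatAdj-sym (backbone-path-adjacent (<-trans (n<1+n _) next<))))
             (spine-leaf i a)
             (subst (λ w → CatAdj L m w (backbone-path (2 + toℕ i))) (backbone-path-spine i)
                    (backbone-path-adjacent next<))
             (position-separates (position-backbone-path prev<) (position-middle-leaf i a 2≤p p<L) (n<1+n _))
             (position-separates (position-middle-leaf i a 2≤p p<L) (position-backbone-path next<) (n<1+n _))
             (position-separates (position-backbone-path prev<) (position-backbone-path next<) (s≤s (n≤1+n _)))
             ci
        where
        next< : 2 + toℕ i < 2 + L
        next< = s≤s (≤-trans p<L (n≤1+n L))
        prev< : toℕ i < 2 + L
        prev< = <-trans (s≤s (n≤1+n _)) next<

      leaves-equal-at-c₁-end : ∀ {i z} → c (spine i) ≡ c₁ → CatAdj L m (spine i) z →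
                               (∀ a → leaf i a ≢ z) → ∀ (a b : Fin (m i)) → a ≡ b
      leaves-equal-at-c₁-end {i} ci iz leaf≢z a b with a ≟ b
      ... | yes a≡b = a≡b
      ... | no a≢b =
        ⊥-elim (claw (spine-leaf i a) (spine-leaf i b) iz (λ { refl → a≢b refl }) (leaf≢z b) (leaf≢z a) ci)

      single-first-leaf : t 1 ≡ c₁ → ValAt L m 1 1
      single-first-leaf t₁≡c₁ zero refl =
        ≤-antisym (Fin-subsingleton⇒≤1 (leaves-equal-at-c₁-end c₀≡c₁ adjacent leaf≢z)) (ends zero (inj₁ refl))
        where
        c₀≡c₁ : c (spine zero) ≡ c₁
        c₀≡c₁ = trans (cong c (sym (backbone-path-spine zero))) t₁≡c₁
        adjacent : CatAdj L m (spine zero) (backbone-path 2)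
        adjacent = subst (λ w → CatAdj L m w (backbone-path 2)) (backbone-path-spine zero)
                         (backbone-path-adjacent (s≤s (s≤s (s≤s z≤n))))
        leaf≢z : ∀ a → leaf zero a ≢ backbone-path 2
        leaf≢z a = position-separates refl (position-backbone-path (s≤s (s≤s (s≤s z≤n)))) (s≤s z≤n)
      single-first-leaf _ (suc i) ()

      single-last-leaf : t L ≡ c₁ → ValAt L m L 1
      single-last-leaf tL≡c₁ i 1+i≡L with toℕ-injective (suc-injective (trans 1+i≡L (sym toℕ-lastᴸ)))
      ... | refl =
        ≤-antisym (Fin-subsingleton⇒≤1 (leaves-equal-at-c₁-end cL≡c₁ adjacent leaf≢z)) (ends lastᴸ (inj₂ toℕ-lastᴸ))
        where
        path-at-last : backbone-path L ≡ spine lastᴸ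
        path-at-last = subst (λ p → backbone-path p ≡ spine lastᴸ) toℕ-lastᴸ (backbone-path-spine lastᴸ)
        cL≡c₁ : c (spine lastᴸ) ≡ c₁
        cL≡c₁ = trans (cong c (sym path-at-last)) tL≡c₁
        adjacent : CatAdj L m (spine lastᴸ) (backbone-path (suc n))
        adjacent = subst (λ w → CatAdj L m w (backbone-path (suc n))) path-at-last
                         (CatAdj-sym (backbone-path-adjacent (s≤s (n≤1+n _))))
        leaf≢z : ∀ a → leaf lastᴸ a ≢ backbone-path (suc n)
        leaf≢z a e = position-separates (position-backbone-path (<-trans (n<1+n _) (s≤s (n≤1+n _))))
                       (position-last-leaf (fromℕ n) a (toℕ-fromℕ n)) (s≤s (n≤1+n _)) (sym e)

      forced-leafless : LeaflessInterior L m (c₁-indicator (t 2) ⁻¹)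
      forced-leafless i 2≤p p<L parity≡ = ¬Fin⇒≡0 (no-leaf-at-interior-c₁ i 2≤p p<L ci≡c₁)
        where
        ci≡c₁ : c (spine i) ≡ c₁
        ci≡c₁ = trans (cong c (sym (backbone-path-spine i)))
                      (Equivalence.from (c₁-interior⇔parity (path-packing pk) 2≤p p<L) parity≡)

    fewer-colours-impossible : ∀ j → j < 3 → ¬ PackingColorable G j
    fewer-colours-impossible j j<3 (c , pk) =
      [ not-c₃ 0 , [ not-c₃ 1 , [ not-c₃ 2 , not-c₃ 3 ]′ ]′ ]′
        (c₃-among-four (PathPacking-window (path-packing (packing-inject≤ pk j≤3)) 0 (s≤s (s≤s (s≤s (s≤s z≤n))))))
      where
      j≤3 : j ≤ 3
      j≤3 = <⇒≤ j<3
      not-c₃ : ∀ p → inject≤ (c (backbone-path p)) j≤3 ≢ c₃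
      not-c₃ p e = <⇒≱ (<-≤-trans (toℕ<n (c (backbone-path p))) (≤-pred j<3))
                       (subst (2 ≤_) (toℕ-inject≤ (c (backbone-path p)) j≤3) (≤-reflexive (cong toℕ (sym e))))

module _ {l : ℕ} where

  opposite-sum : ∀ (i : Fin l) → toℕ (opposite i) + suc (toℕ i) ≡ l
  opposite-sum i = trans (cong (_+ suc (toℕ i)) (opposite-prop i)) (m∸n+n≡m (toℕ<n i))

  opposite-position : ∀ {i : Fin l} {p q} → suc (toℕ i) ≡ q → p + q ≡ suc l → suc (toℕ (opposite i)) ≡ p
  opposite-position {i} {p} {q} refl p+q≡1+l = +-cancelʳ-≡ q _ _ (trans (cong suc (opposite-sum i)) (sym p+q≡1+l))

  opposite-next : ∀ {i j : Fin l} → suc (toℕ i) ≡ toℕ j → toℕ (opposite i) ≡ suc (toℕ (opposite j))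
  opposite-next {i} {j} e = suc-injective (opposite-position refl (begin
    suc (suc (toℕ (opposite j))) + suc (toℕ i) ≡⟨ sym (+-suc (suc (toℕ (opposite j))) (suc (toℕ i))) ⟩
    suc (toℕ (opposite j)) + suc (suc (toℕ i)) ≡⟨ cong (λ q → suc (toℕ (opposite j)) + suc q) e ⟩
    suc (toℕ (opposite j)) + suc (toℕ j)       ≡⟨ cong suc (opposite-sum j) ⟩
    suc l                                      ∎))
    where open ≡-Reasoning

  mirror : ∀ {F F′ : Fin l → ℕ} → (∀ {i} → Fin (F i) → Fin (F′ (opposite i))) → CatV l F → CatV l F′
  mirror g (spine i) = spine (opposite i)
  mirror g (leaf i a) = leaf (opposite i) (g a)

  mirror-adjacent : ∀ {F F′ : Fin l → ℕ} (g : ∀ {i} → Fin (F i) → Fin (F′ (opposite i))) →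
                    ∀ {x y} → CatAdj l F x y → CatAdj l F′ (mirror g x) (mirror g y)
  mirror-adjacent g (spine-next i j e) = spine-prev _ _ (opposite-next e)
  mirror-adjacent g (spine-prev i j e) = spine-next _ _ (sym (opposite-next (sym e)))
  mirror-adjacent g (spine-leaf i a) = spine-leaf _ _
  mirror-adjacent g (leaf-spine i a) = leaf-spine _ _

reverse-iso : ∀ {l} (m : Fin l → ℕ) → Iso (Caterpillar l m) (Caterpillar l (m ∘ opposite))
reverse-iso {l} m = record
  { bij = mk↔ₛ′ reverse unreverse reverse-unreverse unreverse-reverse
  ; adj⇔ = λ u v → mk⇔ (mirror-adjacent transport)
                        (subst₂ (CatAdj l m) (unreverse-reverse u) (unreverse-reverse v) ∘ mirror-adjacent id)
  }
  where
  open Decidable⇒UIP (_≟_ {l}) using (≡-irrelevant)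

  transport : ∀ {i} → Fin (m i) → Fin (m (opposite (opposite i)))
  transport {i} = subst (Fin ∘ m) (sym (opposite-involutive i))

  reverse : CatV l m → CatV l (m ∘ opposite)
  reverse = mirror transport

  unreverse : CatV l (m ∘ opposite) → CatV l m
  unreverse = mirror id

  leaf-subst : ∀ {F : Fin l → ℕ} {i j} (i≡j : i ≡ j) (a : Fin (F i)) →
               leaf {l} {F} j (subst (Fin ∘ F) i≡j a) ≡ leaf i a
  leaf-subst refl a = refl

  unreverse-reverse : ∀ x → unreverse (reverse x) ≡ x
  unreverse-reverse (spine i) = cong spine (opposite-involutive i)
  unreverse-reverse (leaf i a) = leaf-subst (sym (opposite-involutive i)) a

  reverse-unreverse : ∀ y → reverse (unreverse y) ≡ y
  reverse-unreverse (spine j) = cong spine (opposite-involutive j)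
  reverse-unreverse (leaf j b) =
    trans (cong (leaf (opposite (opposite j))) same-transport)
          (leaf-subst {F = m ∘ opposite} (sym (opposite-involutive j)) b)
    where
    same-transport : transport b ≡ subst (Fin ∘ m ∘ opposite) (sym (opposite-involutive j)) b
    same-transport = trans (cong (λ e → subst (Fin ∘ m) e b) (≡-irrelevant _ _))
                           (sym (subst-∘ (sym (opposite-involutive j))))

reflection-≥2 : ∀ {p q l} → p + q ≡ suc l → q < l → 2 ≤ p
reflection-≥2 {p} {q} {l} p+q≡1+l q<l = ≮⇒≥ λ p<2 → <⇒≱ (n<1+n l) (begin
  suc l   ≡⟨ sym p+q≡1+l ⟩
  p + q   ≤⟨ +-monoˡ-≤ q (≤-pred p<2) ⟩
  suc q   ≤⟨ q<l ⟩
  l       ∎)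
  where open ≤-Reasoning

reflection-< : ∀ {p q l} → p + q ≡ suc l → 2 ≤ q → p < l
reflection-< {p} {q} {l} p+q≡1+l 2≤q = ≤-pred (begin
  2 + p   ≡⟨ +-comm 2 p ⟩
  p + 2   ≤⟨ +-monoʳ-≤ p 2≤q ⟩
  p + q   ≡⟨ p+q≡1+l ⟩
  suc l   ∎)
  where open ≤-Reasoning

parity-complement : ∀ {p q s} → p + q ≡ s → parity p ≡ parity s ℙ.+ parity q
parity-complement {p} {q} refl = begin
  parity p                               ≡⟨ sym (ℙ-+-identityʳ (parity p)) ⟩
  parity p ℙ.+ 0ℙ                        ≡⟨ cong (parity p ℙ.+_) (sym (p+p≡0ℙ (parity q))) ⟩
  parity p ℙ.+ (parity q ℙ.+ parity q)   ≡⟨ sym (ℙ-+-assoc (parity p) (parity q) (parity q)) ⟩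
  (parity p ℙ.+ parity q) ℙ.+ parity q   ≡⟨ cong (ℙ._+ parity q) (sym (+-homo-+ p q)) ⟩
  parity (p + q) ℙ.+ parity q            ∎
  where open ≡-Reasoning

module _ {l : ℕ} {m : Fin l → ℕ} where

  ValAt-reverse : ∀ {p q v} → p + q ≡ suc l → ValAt l m p v → ValAt l (m ∘ opposite) q v
  ValAt-reverse p+q≡1+l at-p i 1+i≡q = at-p (opposite i) (opposite-position 1+i≡q p+q≡1+l)

  EndsPos-reverse : EndsPos l m → EndsPos l (m ∘ opposite)
  EndsPos-reverse ends i (inj₁ i≡0) = ends (opposite i) (inj₂ (opposite-position (cong suc i≡0) (+-comm l 1)))
  EndsPos-reverse ends i (inj₂ 1+i≡l) = ends (opposite i) (inj₁ (suc-injective (opposite-position 1+i≡l refl)))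

  LeaflessInterior-reverse : ∀ {π} → LeaflessInterior l m π →
                             LeaflessInterior l (m ∘ opposite) (parity (suc l) ℙ.+ π)
  LeaflessInterior-reverse {π} leafless i 2≤q q<l parity-q =
    leafless (opposite i) (reflection-≥2 p+q≡1+l q<l) (reflection-< p+q≡1+l 2≤q) parity-p
    where
    p q : ℕ
    p = suc (toℕ (opposite i))
    q = suc (toℕ i)
    p+q≡1+l : p + q ≡ suc l
    p+q≡1+l = cong suc (opposite-sum i)
    parity-p : parity p ≡ π
    parity-p = begin
      parity p                                      ≡⟨ parity-complement {p} {q} p+q≡1+l ⟩
      parity (suc l) ℙ.+ parity q                   ≡⟨ cong (parity (suc l) ℙ.+_) parity-q ⟩
      parity (suc l) ℙ.+ (parity (suc l) ℙ.+ π)     ≡⟨ sym (ℙ-+-assoc (parity (suc l)) _ π) ⟩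
      (parity (suc l) ℙ.+ parity (suc l)) ℙ.+ π     ≡⟨ cong (ℙ._+ π) (p+p≡0ℙ (parity (suc l))) ⟩
      π                                             ∎
      where open ≡-Reasoning

Odd⇒parity≡1ℙ : ∀ p → Odd p → parity p ≡ 1ℙ
Odd⇒parity≡1ℙ _ (j , refl) = trans (parity-suc (j + j)) (cong _⁻¹ (trans (+-homo-+ j j) (p+p≡0ℙ (parity j))))

Even⇒parity≡0ℙ : ∀ p → Even p → parity p ≡ 0ℙ
Even⇒parity≡0ℙ _ (j , refl) = trans (+-homo-+ j j) (p+p≡0ℙ (parity j))

parity≡1ℙ⇒Odd : ∀ p → parity p ≡ 1ℙ → Odd p
parity≡0ℙ⇒Even : ∀ p → parity p ≡ 0ℙ → Even p
parity≡1ℙ⇒Odd (suc zero) _ = 0 , refl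
parity≡1ℙ⇒Odd (suc (suc p)) odd with parity≡1ℙ⇒Odd p odd
... | j , refl = suc j , cong (λ q → suc (suc q)) (sym (+-suc j j))
parity≡0ℙ⇒Even zero _ = 0 , refl
parity≡0ℙ⇒Even (suc (suc p)) even with parity≡0ℙ⇒Even p even
... | j , refl = suc j , cong suc (sym (+-suc j j))

parity[1+4k]≡1ℙ : ∀ k → parity (suc (4 * k)) ≡ 1ℙ
parity[1+4k]≡1ℙ k = trans (parity-suc (4 * k)) (cong _⁻¹ (*-homo-* 4 k))

parity[1+4k+r]≡parity[1+r] : ∀ k r → parity (suc (4 * k + r)) ≡ parity (suc r)
parity[1+4k+r]≡parity[1+r] k r = trans (cong parity (sym (+-suc (4 * k) r)))
                           (trans (+-homo-+ (4 * k) (suc r)) (cong (ℙ._+ parity (suc r)) (*-homo-* 4 k)))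

leafless⇒ZeroOn-Odd : ∀ {l m b} → LeaflessInterior l m 1ℙ → b < l → ZeroOn l m Odd 3 b
leafless⇒ZeroOn-Odd leafless b<l i odd 3≤p p≤b =
  leafless i (≤-trans (s≤s (s≤s z≤n)) 3≤p) (≤-<-trans p≤b b<l) (Odd⇒parity≡1ℙ _ odd)

leafless⇒ZeroOn-Even : ∀ {l m b} → LeaflessInterior l m 0ℙ → b < l → ZeroOn l m Even 2 b
leafless⇒ZeroOn-Even leafless b<l i even 2≤p p≤b =
  leafless i 2≤p (≤-<-trans p≤b b<l) (Even⇒parity≡0ℙ _ even)

LeaflessInterior-reverse-4k+r : ∀ k r {m π} → LeaflessInterior (4 * k + r) m π →
                                LeaflessInterior (4 * k + r) (m ∘ opposite) (parity (suc r) ℙ.+ π)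
LeaflessInterior-reverse-4k+r k r leafless =
  subst (LeaflessInterior _ _) (cong (ℙ._+ _) (parity[1+4k+r]≡parity[1+r] k r)) (LeaflessInterior-reverse leafless)

ZeroOn⇒leafless : ∀ {l m π} {P : ℕ → Set} {a b} → ZeroOn l m P a b → (∀ p → parity p ≡ π → P p) →
                  (∀ {p} → 2 ≤ p → p < l → parity p ≡ π → a ≤ p × p ≤ b) → LeaflessInterior l m π
ZeroOn⇒leafless zero-on π⇒P range i 2≤p p<l parity≡ =
  zero-on i (π⇒P _ parity≡) (proj₁ (range 2≤p p<l parity≡)) (proj₂ (range 2≤p p<l parity≡))

4*k+r≡r+k*4 : ∀ k r → 4 * k + r ≡ r + k * 4
4*k+r≡r+k*4 k r = trans (+-comm (4 * k) r) (cong (r +_) (*-comm 4 k))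

data Residue4 : ℕ → Set where
  4k   : ∀ k → Residue4 (4 * k)
  4k+1 : ∀ k → Residue4 (4 * k + 1)
  4k+2 : ∀ k → Residue4 (4 * k + 2)
  4k+3 : ∀ k → Residue4 (4 * k + 3)

residue4 : ∀ l → Residue4 l
residue4 zero = 4k 0
residue4 (suc l) with residue4 l
... | 4k k = subst Residue4 (+-comm (4 * k) 1) (4k+1 k)
... | 4k+1 k = subst Residue4 (+-suc (4 * k) 1) (4k+2 k)
... | 4k+2 k = subst Residue4 (+-suc (4 * k) 2) (4k+3 k)
... | 4k+3 k = subst Residue4 (trans (*-suc 4 k) (cong suc (+-comm 3 (4 * k)))) (4k (suc k))

pattern in𝒢₁ g = inj₁ g
pattern in𝒢₂ g = inj₂ (inj₁ g)
pattern in𝒢₃ g = inj₂ (inj₂ (inj₁ g))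
pattern in𝒢₄ g = inj₂ (inj₂ (inj₂ (inj₁ g)))
pattern in𝒢₅ g = inj₂ (inj₂ (inj₂ (inj₂ (inj₁ g))))
pattern in𝒢₆ g = inj₂ (inj₂ (inj₂ (inj₂ (inj₂ (inj₁ g)))))
pattern in𝒢₇ g = inj₂ (inj₂ (inj₂ (inj₂ (inj₂ (inj₂ g)))))

module _ {l : ℕ} {m : Fin l → ℕ} where

  as-is : InFamilies l m → BelongsToFamilies (Caterpillar l m)
  as-is fam = l , m , fam , record { bij = ↔-id _ ; adj⇔ = λ _ _ → ⇔-id _ }

  reversed : InFamilies l (m ∘ opposite) → BelongsToFamilies (Caterpillar l m)
  reversed fam = l , m ∘ opposite , fam , reverse-iso m

SingleLeafEnd : (l : ℕ) → (Fin l → ℕ) → Set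
SingleLeafEnd l m = ValAt l m 1 1 ⊎ ValAt l m l 1

belongs-if-odd-interior-leafless :
  ∀ {l m} → 2 ≤ l → EndsPos l m → LeaflessInterior l m 1ℙ →
  (l ≡ 3 → SingleLeafEnd l m) → (∀ k → l ≡ 5 + k * 4 → SingleLeafEnd l m) →
  BelongsToFamilies (Caterpillar l m)
belongs-if-odd-interior-leafless {l} {m} 2≤l ends leafless single-end-if-3 single-end-if-5+4k with residue4 l
... | 4k zero = ⊥-elim (2≰1 (≤-trans 2≤l z≤n))
... | 4k (suc k) = as-is (in𝒢₁ (ends , suc k , s≤s z≤n , refl , leafless⇒ZeroOn-Odd leafless (n<1+n _)))
... | 4k+1 zero = ⊥-elim (2≰1 2≤l)
... | 4k+1 (suc k) = [ first , last ]′ (single-end-if-5+4k k (4*k+r≡r+k*4 (suc k) 1))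
  where
  first : ValAt _ m 1 1 → BelongsToFamilies (Caterpillar _ m)
  first at-1 = as-is (in𝒢₂ (ends , suc k , s≤s z≤n , refl , at-1 , leafless⇒ZeroOn-Odd leafless (s≤s (m≤m+n _ 1))))
  last : ValAt _ m _ 1 → BelongsToFamilies (Caterpillar _ m)
  last at-l = reversed (in𝒢₂ (EndsPos-reverse ends , suc k , s≤s z≤n , refl , ValAt-reverse (+-comm _ 1) at-l ,
                              leafless⇒ZeroOn-Odd (LeaflessInterior-reverse-4k+r (suc k) 1 leafless)
                                                  (s≤s (m≤m+n _ 1))))
... | 4k+2 k = as-is (in𝒢₄ (ends , k , refl , leafless⇒ZeroOn-Odd leafless (+-monoʳ-< (4 * k) ≤-refl)))
... | 4k+3 zero = [ first , last ]′ (single-end-if-3 refl)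
  where
  first : ValAt 3 m 1 1 → BelongsToFamilies (Caterpillar 3 m)
  first at-1 = reversed (in𝒢₆ (EndsPos-reverse ends , refl , ValAt-reverse refl at-1))
  last : ValAt 3 m 3 1 → BelongsToFamilies (Caterpillar 3 m)
  last at-3 = as-is (in𝒢₆ (ends , refl , at-3))
... | 4k+3 (suc k) =
  as-is (in𝒢₅ (ends , suc k , s≤s z≤n , refl ,
               leafless⇒ZeroOn-Odd leafless (+-monoʳ-< (4 * suc k) (s≤s (s≤s z≤n)))))

belongs-if-even-interior-leafless :
  ∀ {l m} → 2 ≤ l → EndsPos l m → LeaflessInterior l m 0ℙ → BelongsToFamilies (Caterpillar l m)
belongs-if-even-interior-leafless {l} {m} 2≤l ends leafless with residue4 l
... | 4k zero = ⊥-elim (2≰1 (≤-trans 2≤l z≤n))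
... | 4k (suc k) =
  reversed (in𝒢₁ (EndsPos-reverse ends , suc k , s≤s z≤n , refl , leafless⇒ZeroOn-Odd reversed-leafless (n<1+n _)))
  where
  reversed-leafless : LeaflessInterior _ (m ∘ opposite) 1ℙ
  reversed-leafless = subst (LeaflessInterior _ _) (cong (ℙ._+ 0ℙ) (parity[1+4k]≡1ℙ (suc k)))
                            (LeaflessInterior-reverse leafless)
... | 4k+1 zero = ⊥-elim (2≰1 2≤l)
... | 4k+1 (suc k) = as-is (in𝒢₃ (ends , suc k , s≤s z≤n , refl , leafless⇒ZeroOn-Even leafless (m<m+n _ (s≤s z≤n))))
... | 4k+2 k =
  reversed (in𝒢₄ (EndsPos-reverse ends , k , refl ,
                  leafless⇒ZeroOn-Odd (LeaflessInterior-reverse-4k+r k 2 leafless) (+-monoʳ-< (4 * k) ≤-refl)))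
... | 4k+3 k = as-is (in𝒢₇ (ends , k , refl , leafless⇒ZeroOn-Even leafless (+-monoʳ-< (4 * k) ≤-refl)))

module _ (n : ℕ) (m : Fin (2 + n) → ℕ) (ends : EndsPos (2 + n) m)
         {c : CatV (2 + n) m → Colour} (pk : IsPackingColoring (Caterpillar (2 + n) m) 3 c) where

  open Backbone n m
  open BackbonePath ends
  open Forced pk

  private
    single-leaf-end : t 1 ≡ c₁ ⊎ t L ≡ c₁ → SingleLeafEnd L m
    single-leaf-end = Sum.map single-first-leaf single-last-leaf

    end-if-c₁-near-ends : ∀ {q} → L ≡ q → t 2 ≢ c₁ → t 1 ≡ c₁ ⊎ t 2 ≡ c₁ ⊎ t q ≡ c₁ → SingleLeafEnd L m
    end-if-c₁-near-ends refl t₂≢c₁ = single-leaf-end ∘ [ inj₁ , [ ⊥-elim ∘ t₂≢c₁ , inj₂ ]′ ]′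

  packing⇒belongs : BelongsToFamilies G
  packing⇒belongs with t 2 ≟ c₁
  ... | yes t₂≡c₁ =
    belongs-if-even-interior-leafless (s≤s (s≤s z≤n)) ends
      (subst (LeaflessInterior L m) (cong (λ x → c₁-indicator x ⁻¹) t₂≡c₁) forced-leafless)
  ... | no t₂≢c₁ =
    belongs-if-odd-interior-leafless (s≤s (s≤s z≤n)) ends
      (subst (LeaflessInterior L m) (cong _⁻¹ (c₁-indicator-≢c₁ t₂≢c₁)) forced-leafless)
      (λ L≡3 → end-if-c₁-near-ends L≡3 t₂≢c₁
                 (c₁-among-three (PathPacking-window (path-packing pk) 1 (s≤s (s≤s (s≤s (s≤s z≤n)))))))
      (λ k L≡5+4k → end-if-c₁-near-ends L≡5+4k t₂≢c₁
                      (c₁-near-ends k (subst (PathPacking t) (cong (2 +_) L≡5+4k) (path-packing pk))))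

infixl 6 _^_

_^_ : List Colour → ℕ → List Colour
B ^ zero = []
B ^ suc K = B ++ B ^ K

-- Positions past the end read colour 1.
_!_ : List Colour → ℕ → Colour
[] ! _ = c₁
(x ∷ xs) ! zero = x
(x ∷ xs) ! suc p = xs ! p

applyUpTo-! : ∀ xs → applyUpTo (xs !_) (length xs) ≡ xs
applyUpTo-! [] = refl
applyUpTo-! (x ∷ xs) = cong (x ∷_) (applyUpTo-! xs)

packingᵇ⇒PathPacking : ∀ xs → T (packingᵇ xs) → PathPacking (xs !_) (length xs)
packingᵇ⇒PathPacking xs packed =
  Equivalence.from (PathPacking⇔packingᵇ (xs !_) (length xs))
                   (subst (T ∘ packingᵇ) (sym (applyUpTo-! xs)) packed)

++-! : ∀ xs ys i → (xs ++ ys) ! (length xs + i) ≡ ys ! i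
++-! [] ys i = refl
++-! (x ∷ xs) ys i = ++-! xs ys i

^-++-! : ∀ B K v j → (B ^ K ++ v) ! (j + K * length B) ≡ v ! j
^-++-! B K v j = subst (λ i → (B ^ K ++ v) ! i ≡ v ! j) (+-comm (K * length B) j) (go K)
  where
  go : ∀ K → (B ^ K ++ v) ! (K * length B + j) ≡ v ! j
  go zero = refl
  go (suc K) = begin
    ((B ++ B ^ K) ++ v) ! ((length B + K * length B) + j)
      ≡⟨ cong₂ _!_ (++-assoc B (B ^ K) v) (+-assoc (length B) _ j) ⟩
    (B ++ (B ^ K ++ v)) ! (length B + (K * length B + j)) ≡⟨ ++-! B (B ^ K ++ v) _ ⟩
    (B ^ K ++ v) ! (K * length B + j)                     ≡⟨ go K ⟩
    v ! j                                                 ∎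
    where open ≡-Reasoning

length-^-++ : ∀ B K v → length (B ^ K ++ v) ≡ length v + K * length B
length-^-++ B K v = begin
  length (B ^ K ++ v)          ≡⟨ length-++ (B ^ K) ⟩
  length (B ^ K) + length v    ≡⟨ +-comm (length (B ^ K)) (length v) ⟩
  length v + length (B ^ K)    ≡⟨ cong (length v +_) (length-^ K) ⟩
  length v + K * length B      ∎
  where
  open ≡-Reasoning
  length-^ : ∀ K → length (B ^ K) ≡ K * length B
  length-^ zero = refl
  length-^ (suc K) = trans (length-++ B) (cong (length B +_) (length-^ K))

colourable-from-word : ∀ {l} {m : Fin l → ℕ} n → l ≡ 2 + n → (xs : List Colour) → T (packingᵇ xs) →
  length xs ≡ 4 + n → LeaflessInterior l m (c₁-indicator (xs ! 2) ⁻¹) →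
  (xs ! 0 ≢ c₁ → ValAt l m 1 1) → (xs ! (3 + n) ≢ c₁ → ValAt l m l 1) →
  PackingColorable (Caterpillar l m) 3
colourable-from-word {m = m} n refl xs packed length≡ leafless first last =
  colour , extension-packing leafless first last
  where
  open Backbone n m
  open Extension (xs !_) (subst (PathPacking (xs !_)) length≡ (packingᵇ⇒PathPacking xs packed))

≤-of-< : ∀ {p l b} → p < l → l ≡ suc b → p ≤ b
≤-of-< p<l refl = ≤-pred p<l

≤-of-<-parity : ∀ {p l b} → p < l → l ≡ suc (suc b) → parity p ≢ parity (suc b) → p ≤ b
≤-of-<-parity p<l refl parity≢ = ≤-pred (≤∧≢⇒< (≤-pred p<l) (parity≢ ∘ cong parity))

3≤odd : ∀ {p} → 2 ≤ p → parity p ≡ 1ℙ → 3 ≤ p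
3≤odd {zero} () _
3≤odd {suc zero} (s≤s ()) _
3≤odd {suc (suc zero)} _ ()
3≤odd {suc (suc (suc p))} _ _ = s≤s (s≤s (s≤s z≤n))

-- packingᵇ looks at most three entries ahead, so on each word below it reduces the word with
-- K + 2 periods to the word with K + 1 periods: the inductive step of `packed` is definitional.
𝒢₁-colourable : ∀ {l m} → 𝒢₁ l m → PackingColorable (Caterpillar l m) 3
𝒢₁-colourable (_ , suc K , _ , l≡4k , zero-odd) =
  colourable-from-word (2 + K * 4) (trans l≡4k (*-comm 4 (suc K))) (word K) (packed K)
    (cong (3 +_) (length-^-++ B K v))
    (ZeroOn⇒leafless zero-odd parity≡1ℙ⇒Odd (λ 2≤p p<l odd → 3≤odd 2≤p odd , ≤-of-< p<l l≡4k))
    (λ c₁≢c₁ → ⊥-elim (c₁≢c₁ refl)) (λ last≢c₁ → ⊥-elim (last≢c₁ (^-++-! B K v 2)))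
  where
  B v : List Colour
  B = c₁ ∷ c₂ ∷ c₁ ∷ c₃ ∷ []
  v = c₁ ∷ c₂ ∷ c₁ ∷ []
  word : ℕ → List Colour
  word K = c₁ ∷ c₂ ∷ c₃ ∷ B ^ K ++ v
  packed : ∀ K → T (packingᵇ (word K))
  packed zero = _
  packed (suc zero) = _
  packed (suc (suc K)) = packed (suc K)

𝒢₂-colourable : ∀ {l m} → 𝒢₂ l m → PackingColorable (Caterpillar l m) 3
𝒢₂-colourable (_ , suc K , _ , l≡4k+1 , at-1 , zero-odd) =
  colourable-from-word (3 + K * 4) (trans l≡4k+1 (4*k+r≡r+k*4 (suc K) 1)) (word K) (packed K)
    (cong (3 +_) (length-^-++ B K v))
    (ZeroOn⇒leafless zero-odd parity≡1ℙ⇒Odd λ 2≤p p<l odd →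
       3≤odd 2≤p odd , ≤-of-<-parity p<l (trans l≡4k+1 (cong suc (+-comm _ 1)))
                                         (λ p≡ → 1ℙ≢0ℙ (trans (sym odd) (trans p≡ (*-homo-* 4 (suc K))))))
    (λ _ → at-1) (λ last≢c₁ → ⊥-elim (last≢c₁ (^-++-! B K v 3)))
  where
  B v : List Colour
  B = c₁ ∷ c₃ ∷ c₁ ∷ c₂ ∷ []
  v = c₁ ∷ c₃ ∷ c₂ ∷ c₁ ∷ []
  word : ℕ → List Colour
  word K = c₃ ∷ c₁ ∷ c₂ ∷ B ^ K ++ v
  packed : ∀ K → T (packingᵇ (word K))
  packed zero = _
  packed (suc zero) = _
  packed (suc (suc K)) = packed (suc K)

𝒢₃-colourable : ∀ {l m} → 𝒢₃ l m → PackingColorable (Caterpillar l m) 3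
𝒢₃-colourable (_ , suc K , _ , l≡4k+1 , zero-even) =
  colourable-from-word (3 + K * 4) (trans l≡4k+1 (4*k+r≡r+k*4 (suc K) 1)) (word K) (packed K)
    (cong (3 +_) (length-^-++ B K v))
    (ZeroOn⇒leafless zero-even parity≡0ℙ⇒Even λ 2≤p p<l _ → 2≤p , ≤-of-< p<l (trans l≡4k+1 (+-comm _ 1)))
    (λ c₁≢c₁ → ⊥-elim (c₁≢c₁ refl)) (λ last≢c₁ → ⊥-elim (last≢c₁ (^-++-! B K v 3)))
  where
  B v : List Colour
  B = c₃ ∷ c₁ ∷ c₂ ∷ c₁ ∷ []
  v = c₃ ∷ c₁ ∷ c₂ ∷ c₁ ∷ []
  word : ℕ → List Colour
  word K = c₁ ∷ c₂ ∷ c₁ ∷ B ^ K ++ v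
  packed : ∀ K → T (packingᵇ (word K))
  packed zero = _
  packed (suc zero) = _
  packed (suc (suc K)) = packed (suc K)

𝒢₄-colourable : ∀ {l m} → 𝒢₄ l m → PackingColorable (Caterpillar l m) 3
𝒢₄-colourable (_ , K , l≡4k+2 , zero-odd) =
  colourable-from-word (K * 4) (trans l≡4k+2 (4*k+r≡r+k*4 K 2)) (word K) (packed K)
    (cong (3 +_) (length-^-++ B K v))
    (ZeroOn⇒leafless zero-odd parity≡1ℙ⇒Odd λ 2≤p p<l odd →
       3≤odd 2≤p odd , ≤-of-< p<l (trans l≡4k+2 (+-suc (4 * K) 1)))
    (λ c₁≢c₁ → ⊥-elim (c₁≢c₁ refl)) (λ last≢c₁ → ⊥-elim (last≢c₁ (^-++-! B K v 0)))
  where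
  B v : List Colour
  B = c₁ ∷ c₂ ∷ c₁ ∷ c₃ ∷ []
  v = c₁ ∷ []
  word : ℕ → List Colour
  word K = c₁ ∷ c₂ ∷ c₃ ∷ B ^ K ++ v
  packed : ∀ K → T (packingᵇ (word K))
  packed zero = _
  packed (suc zero) = _
  packed (suc (suc K)) = packed (suc K)

𝒢₅-colourable : ∀ {l m} → 𝒢₅ l m → PackingColorable (Caterpillar l m) 3
𝒢₅-colourable (_ , suc K , _ , l≡4k+3 , zero-odd) =
  colourable-from-word (5 + K * 4) (trans l≡4k+3 (4*k+r≡r+k*4 (suc K) 3)) (word K) (packed K)
    (cong (3 +_) (length-^-++ B K v))
    (ZeroOn⇒leafless zero-odd parity≡1ℙ⇒Odd λ 2≤p p<l odd →
       3≤odd 2≤p odd ,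
       ≤-of-<-parity p<l (trans l≡4k+3 (trans (+-suc (4 * suc K) 2) (cong suc (+-suc (4 * suc K) 1))))
                     (λ p≡ → 1ℙ≢0ℙ (trans (sym odd) (trans p≡ (parity[1+4k+r]≡parity[1+r] (suc K) 1)))))
    (λ c₁≢c₁ → ⊥-elim (c₁≢c₁ refl)) (λ last≢c₁ → ⊥-elim (last≢c₁ (^-++-! B K v 5)))
  where
  B v : List Colour
  B = c₁ ∷ c₂ ∷ c₁ ∷ c₃ ∷ []
  v = c₁ ∷ c₂ ∷ c₁ ∷ c₃ ∷ c₂ ∷ c₁ ∷ []
  word : ℕ → List Colour
  word K = c₁ ∷ c₂ ∷ c₃ ∷ B ^ K ++ v
  packed : ∀ K → T (packingᵇ (word K))
  packed zero = _
  packed (suc zero) = _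
  packed (suc (suc K)) = packed (suc K)

𝒢₆-colourable : ∀ {l m} → 𝒢₆ l m → PackingColorable (Caterpillar l m) 3
𝒢₆-colourable (_ , refl , at-3) =
  colourable-from-word 1 refl (c₁ ∷ c₂ ∷ c₃ ∷ c₁ ∷ c₂ ∷ []) _ refl
    (λ i 2≤p p<3 → λ parity≡1ℙ → ⊥-elim (1ℙ≢0ℙ (trans (sym parity≡1ℙ) (cong parity (only-2 i 2≤p p<3)))))
    (λ c₁≢c₁ → ⊥-elim (c₁≢c₁ refl)) (λ _ → at-3)
  where
  only-2 : ∀ (i : Fin 3) → 2 ≤ suc (toℕ i) → suc (toℕ i) < 3 → suc (toℕ i) ≡ 2
  only-2 (suc zero) _ _ = refl
  only-2 zero (s≤s ()) _
  only-2 (suc (suc i)) _ (s≤s (s≤s (s≤s ())))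

𝒢₇-colourable : ∀ {l m} → 𝒢₇ l m → PackingColorable (Caterpillar l m) 3
𝒢₇-colourable (_ , K , l≡4k+3 , zero-even) =
  colourable-from-word (1 + K * 4) (trans l≡4k+3 (4*k+r≡r+k*4 K 3)) (word K) (packed K)
    (cong (3 +_) (length-^-++ B K v))
    (ZeroOn⇒leafless zero-even parity≡0ℙ⇒Even λ 2≤p p<l _ → 2≤p , ≤-of-< p<l (trans l≡4k+3 (+-suc (4 * K) 2)))
    (λ c₁≢c₁ → ⊥-elim (c₁≢c₁ refl)) (λ last≢c₁ → ⊥-elim (last≢c₁ (^-++-! B K v 1)))
  where
  B v : List Colour
  B = c₃ ∷ c₁ ∷ c₂ ∷ c₁ ∷ []
  v = c₃ ∷ c₁ ∷ []
  word : ℕ → List Colour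
  word K = c₁ ∷ c₂ ∷ c₁ ∷ B ^ K ++ v
  packed : ∀ K → T (packingᵇ (word K))
  packed zero = _
  packed (suc zero) = _
  packed (suc (suc K)) = packed (suc K)

family-colourable : ∀ {l m} → InFamilies l m → PackingColorable (Caterpillar l m) 3
family-colourable (in𝒢₁ g) = 𝒢₁-colourable g
family-colourable (in𝒢₂ g) = 𝒢₂-colourable g
family-colourable (in𝒢₃ g) = 𝒢₃-colourable g
family-colourable (in𝒢₄ g) = 𝒢₄-colourable g
family-colourable (in𝒢₅ g) = 𝒢₅-colourable g
family-colourable (in𝒢₆ g) = 𝒢₆-colourable g
family-colourable (in𝒢₇ g) = 𝒢₇-colourable g

theorem18 : (l : ℕ) (m : Fin l → ℕ) → 2 ≤ l → EndsPos l m →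
    PackingChromaticNumberIs (Caterpillar l m) 3 ⇔ BelongsToFamilies (Caterpillar l m)
theorem18 (suc (suc n)) m (s≤s (s≤s z≤n)) ends = mk⇔
  (λ ((c , pk) , _) → packing⇒belongs n m ends pk)
  (λ (_ , _ , fam , iso) → PackingColorable-pullback iso (family-colourable fam)
                         , Backbone.BackbonePath.fewer-colours-impossible n m ends)
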